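{- Let $\alpha=\{a_1,\dots,a_m\}$ and $\beta=\{b_1,\dots,b_m\}$ be multisets of rational numbers in $(0,1]$ with $b_1=1$ such that $\prod_{i=1}^m(X-e^{2\pi i a_i})\in\mathbb Z[X]$ and $\prod_{i=1}^m(X-e^{2\pi i b_i})\in\mathbb Z[X]$. Write $$\frac{\prod_{i=1}^m(X-e^{2\pi i a_i})}{\prod_{i=1}^m(X-e^{2\pi i b_i})}=\frac{(X^{p_1}-1)\cdots(X^{p_r}-1)}{(X^{q_1}-1)\cdots(X^{q_s}-1)}$$ with positive integers $p_i,q_j$ and $\{p_i\}\cap\{q_j\}=\emptyset$. Let $M$ be the least common denominator of the elements of $\alpha\cup\beta$. Sort the $2m$ elements of $\alpha$ and $\beta$ together as $\mu_1\le\cdots\le\mu_{2m}$ (so $\mu_{2m}=1$), where for a value occurring in both multisets all copies from $\beta$ precede all copies from $\alpha$; set $\mu_0=0$. Define $\Phi(0)=r$ and for $i\ge1$, $\Phi(i)=\Phi(i-1)+1$ if $\mu_i$ comes from $\alpha$, $\Phi(i)=\Phi(i-1)-1$ if $\mu_i$ comes from $\beta$. Let $$A(k)=\frac{\prod_{a\in\alpha}(a)_k}{\prod_{b\in\beta}(b)_k},\qquad (a)_k=a(a+1)\cdots(a+k-1).$$ Then for every prime $p\equiv1\pmod M$, every $0\le i\le 2m-1$ and every integer $k$ with $[-\mu_i]_0<k\le[-\mu_{i+1}]_0$, $$\Phi(i)=\operatorname{ord}_pA(k)+r.$$ In particular, for each $i$ with $\mu_i<\mu_{i+1}$, $\Ph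i(i)=\operatorname{ord}_pA(\mu_{i+1}(p-1))+r$.
   Context: For $x\in\mathbb Z_p$, $[x]_0$ denotes the first $p$-adic digit of $x$ (its residue in $\{0,\dots,p-1\}$). For $\mu\in[0,1]$ rational with $(p-1)\mu\in\mathbb Z$ one has $[-\mu]_0=\mu(p-1)$. $\operatorname{ord}_p$ is the $p$-adic valuation. -}

module Defs where

open import Data.Nat as ℕ using (ℕ; zero; suc; _∸_; _^_; _≡ᵇ_)
open import Data.Nat.DivMod using (_%_; _/_)
open import Data.Nat.LCM using (lcm)
open import Data.Nat.Divisibility using (_∣?_)
open import Data.Integer as ℤ using (ℤ; +_)
open import Data.Integer.DivMod using (_%ℕ_)
open import Data.Rational as ℚ using (ℚ; 0ℚ; 1ℚ; _≟_; 1/_; ≢-nonZero)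
open ℚ.ℚ public using (numerator; denominatorℕ)
open import Data.Bool as Bool using (Bool; true; false; if_then_else_)
open import Data.List using (List; []; _∷_; foldr; map; length; filter; take; drop; head)
open import Data.Maybe using (Maybe; just; nothing)
open import Data.Product using (_×_; _,_; proj₁)
open import Relation.Nullary using (yes; no; does)

count : ℚ → List ℚ → ℕ
count x [] = 0
count x (y ∷ ys) = if does (x ≟ y) then suc (count x ys) else count x ys

-- multiplicity of e^{2πi x} (x ∈ (0,1] ∩ ℚ) as a root of X^n - 1 :
-- it is a root (simple) iff n·x ∈ ℤ iff denominator(x) ∣ n
rootMult : ℕ → ℚ → ℕ
rootMult n x = if does (denominatorℕ x ∣? n) then 1 else 0

-- total inverse on ℚ (inverse of 0 set to 0; never used at 0 below)
inv : ℚ → ℚ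
inv x with x ≟ 0ℚ
... | yes _ = 0ℚ
... | no ne = 1/_ x {{≢-nonZero ne}}

poch : ℚ → ℕ → ℚ
poch a zero = 1ℚ
poch a (suc k) = poch a k ℚ.* (a ℚ.+ (+ k ℚ./ 1))

prodℚ : List ℚ → ℚ
prodℚ = foldr ℚ._*_ 1ℚ

A : List ℚ → List ℚ → ℕ → ℚ
A α β k = prodℚ (map (λ a → poch a k) α) ℚ.* inv (prodℚ (map (λ b → poch b k) β))

-- p-adic valuation of a natural number (fuel = n suffices for p ≥ 2)
valAux : ℕ → ℕ → ℕ → ℕ
valAux zero p n = 0
valAux (suc f) zero n = 0
valAux (suc f) (suc zero) n = 0
valAux (suc f) (suc (suc q)) zero = 0
valAux (suc f) (suc (suc q)) (suc n) =
  if (suc n % suc (suc q)) ≡ᵇ 0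
  then suc (valAux f (suc (suc q)) (suc n / suc (suc q)))
  else 0

valℕ : ℕ → ℕ → ℕ
valℕ p n = valAux n p n

-- ord_p of a rational (ord_p 0 is set to 0; not used at 0)
ord : ℕ → ℚ → ℤ
ord p x = + valℕ p ℤ.∣ numerator x ∣ ℤ.- + valℕ p (denominatorℕ x)

-- first p-adic digit [x]_0 of x ∈ ℤ_(p), x = n/d with p ∤ d:
-- the residue of n · d^{-1} mod p, with d^{-1} ≡ d^{p-2} (Fermat)
digit0 : ℕ → ℚ → ℕ
digit0 zero x = 0
digit0 (suc q) x = ((numerator x %ℕ suc q) ℕ.* (denominatorℕ x ^ (q ∸ 1))) % suc q

lcd : List ℚ → ℕ
lcd xs = foldr lcm 1 (map denominatorℕ xs)

-- sorting order on tagged elements (value, fromα): by value, and at equal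
-- values β-copies (false) precede α-copies (true)
data TagLe : ℚ × Bool → ℚ × Bool → Set where
  lt : ∀ {x y s t} → x ℚ.< y → TagLe (x , s) (y , t)
  eq : ∀ {x s t} → s Bool.≤ t → TagLe (x , s) (x , t)

tagα : List ℚ → List (ℚ × Bool)
tagα = map (λ a → a , true)

tagβ : List ℚ → List (ℚ × Bool)
tagβ = map (λ b → b , false)

-- μ_i : μ_0 = 0, μ_i = value of the i-th element (1-based) of the sorted list
mu : List (ℚ × Bool) → ℕ → ℚ
mu L zero = 0ℚ
mu L (suc i) with drop i L
... | [] = 0ℚ
... | (x , _) ∷ _ = x

stepSum : List (ℚ × Bool) → ℤ
stepSum [] = + 0
stepSum ((_ , true) ∷ L) = ℤ.suc (stepSum L)
stepSum ((_ , false) ∷ L) = ℤ.pred (stepSum L)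

Phi : ℕ → List (ℚ × Bool) → ℕ → ℤ
Phi r L i = + r ℤ.+ stepSum (take i L)

-- Let p be prime and x = n/d ∈ (0,1] with p − 1 = e·d. Then c = n·e = x(p − 1) satisfies
-- n + c·d = n·p, so c ≡ −x (mod p) and c < p: c is the first p-adic digit [−x]₀ (reading off
-- the digit as defined in terms of d^(p−2) needs Fermat's little theorem). Among the factors
-- x, x + 1, …, x + p − 1 only x + c = n·p/d has positive valuation, namely 1, so
-- ord_p (x)_k = [c < k] for k ≤ p. Hence ord_p A(k) is the number of entries of α minus the
-- number of entries of β whose digit lies below k. As [−x]₀ = x(p − 1) is monotone in x, for
-- [−μᵢ]₀ < k ≤ [−μᵢ₊₁]₀ these entries are exactly μ₁, …, μᵢ, whose signed count is Φ(i) − r.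

module Submission where

open import Defs
open import Data.Nat as ℕ using (ℕ; suc; _∸_; _+_)
open import Data.Nat.Divisibility using (_∣_)
open import Data.Nat.Primality using (Prime)
open import Data.Integer as ℤ using (ℤ; +_)
open import Data.Rational as ℚ using (ℚ; 0ℚ; 1ℚ)
open import Data.Bool using (Bool)
open import Data.List using (List; length; map; _++_)
open import Data.Nat.ListAction using (sum)
open import Data.List.Relation.Unary.All using (All)
open import Data.List.Relation.Unary.Linked using (Linked)
open import Data.List.Membership.Propositional using (_∈_; _∉_)
open import Data.List.Relation.Binary.Permutation.Propositional using (_↭_)
open import Data.Product using (_×_)
open import Relation.Binary.PropositionalEquality using (_≡_)

open import Data.Nat
open import Data.Nat.Properties
open import Data.Nat.DivMod
open import Data.Nat.Divisibility
open import Data.Nat.Primality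
open import Data.Nat.Combinatorics using (_C_; nCk≡n!/k![n-k]!; k![n∸k]!∣n!; nCn≡1)
open import Data.Nat.Induction using (<-rec)
open import Data.Nat.LCM using (m∣lcm[m,n]; n∣lcm[m,n])
open import Data.Nat.Coprimality using (Coprime)
open import Data.Nat.Tactic.RingSolver using (solve-∀)
open import Data.Fin using (Fin; toℕ; inject₁; fromℕ) renaming (zero to 0F; suc to sucF)
open import Data.Fin.Properties using (toℕ-inject₁; toℕ-fromℕ; toℕ<n)
open import Data.Vec.Functional using (Vector; init)
open import Data.Integer using (+[1+_]; -[1+_]; -1ℤ)
import Data.Integer.Properties as ℤ
import Data.Integer.Tactic.RingSolver as ℤ
open import Data.Rational using (mkℚ; Positive; toℚᵘ)
import Data.Rational.Properties as ℚ
open import Data.Rational.Unnormalised as ℚᵘ using (ℚᵘ; mkℚᵘ; *≡*; _≃_)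
import Data.Rational.Unnormalised.Properties as ℚᵘ
open import Data.Bool using (true; false; if_then_else_)
open import Data.List using ([]; _∷_; foldr; filter; take; drop)
open import Data.List.Properties using (filter-accept; filter-reject; filter-none; filter-++; length-++; length-map)
open import Data.List.Relation.Unary.All using ([]; _∷_)
import Data.List.Relation.Unary.All as All
import Data.List.Relation.Unary.All.Properties as All
open import Data.List.Relation.Unary.AllPairs using (AllPairs; _∷_)
open import Data.List.Relation.Unary.Linked using ([]; [-]; _∷_)
open import Data.List.Relation.Unary.Linked.Properties using (Linked⇒AllPairs)
open import Data.List.Relation.Binary.Permutation.Propositional using (↭-sym; ↭⇒↭ₛ)
open import Data.List.Relation.Binary.Permutation.Propositional.Properties
  using (filter-↭; ↭-length; All-resp-↭) renaming (map⁺ to ↭-map⁺)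
open import Data.List.Relation.Binary.Permutation.Setoid.Properties using (foldr-commMonoid)
open import Data.Product using (∃₂; _,_; proj₁)
open import Data.Sum using (_⊎_; [_,_]′; inj₁; inj₂)
open import Function using (id; _∘_; _on_; flip)
open import Relation.Nullary using (¬_; Dec; yes; no; contradiction)
open import Relation.Unary using (Decidable)
open import Relation.Binary.PropositionalEquality

open import Algebra.Properties.CommutativeSemiring.Binomial +-*-commutativeSemiring as Binomial
  using (binomialTerm)
import Algebra.Properties.CommutativeSemiring.Exp +-*-commutativeSemiring as Semiring
import Algebra.Definitions.RawMonoid +-0-rawMonoid as Monoid
open import Algebra.Properties.Monoid.Sum +-0-monoid using (sum-init-last; sum-cong-≗) renaming (sum to ∑)

-- p-adic valuations

valAux-∤ : ∀ f {p m} → ¬ p ∣ m → valAux f p m ≡ 0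
valAux-∤ zero _ = refl
valAux-∤ (suc f) {0} _ = refl
valAux-∤ (suc f) {1} _ = refl
valAux-∤ (suc f) {2+ _} {zero} _ = refl
valAux-∤ (suc f) {p@(2+ _)} {suc m} p∤m with suc m % p in m%p≡
... | zero = contradiction (m%n≡0⇒n∣m (suc m) p m%p≡) p∤m
... | suc _ = refl

valAux-p* : ∀ f {p} .{{_ : NonTrivial p}} {x} .{{_ : NonZero x}} →
            valAux (suc f) p (p * x) ≡ suc (valAux f p x)
valAux-p* f {p@(2+ _)} {x@(suc _)} = begin
  valAux (suc f) p (p * x)                                       ≡⟨⟩
  (if p * x % p ≡ᵇ 0 then suc (valAux f p (p * x / p)) else 0)   ≡⟨ cong (λ r → if r ≡ᵇ 0 then suc (valAux f p (p * x / p)) else 0) px%p≡0 ⟩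
  suc (valAux f p (p * x / p))                                   ≡⟨ cong (suc ∘ valAux f p) px/p≡x ⟩
  suc (valAux f p x)                                             ∎
  where
  open ≡-Reasoning
  px%p≡0 : p * x % p ≡ 0
  px%p≡0 = trans (cong (_% p) (*-comm p x)) (m*n%n≡0 x p)
  px/p≡x : p * x / p ≡ x
  px/p≡x = trans (cong (_/ p) (*-comm p x)) (m*n/n≡m x p)

∤⇒nonZero : ∀ {p m} → ¬ p ∣ m → NonZero m
∤⇒nonZero {p} p∤m = ≢-nonZero λ { refl → p∤m (p ∣0) }

valAux-p^e*m : ∀ {p} .{{_ : NonTrivial p}} e {m f} → ¬ p ∣ m → p ^ e * m ≤ f → valAux f p (p ^ e * m) ≡ e
valAux-p^e*m zero {m} {f} p∤m _ = valAux-∤ f (p∤m ∘ subst (_ ∣_) (*-identityˡ m))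
valAux-p^e*m {p} (suc e) {m} {f} p∤m = go f
  where
  instance
    _ = nonTrivial⇒nonZero p
    _ = ∤⇒nonZero p∤m
    _ = m^n≢0 p e
    _ = m*n≢0 (p ^ e) m
  p^e*m<p^[1+e]*m : p ^ e * m < p ^ suc e * m
  p^e*m<p^[1+e]*m = subst (p ^ e * m <_) (trans (*-comm (p ^ e * m) p) (sym (*-assoc p (p ^ e) m)))
                          (m<m*n (p ^ e * m) p (nonTrivial⇒n>1 p))
  go : ∀ f → p ^ suc e * m ≤ f → valAux f p (p ^ suc e * m) ≡ suc e
  go zero ≤0 = contradiction (<-≤-trans p^e*m<p^[1+e]*m ≤0) n≮0
  go (suc f) ≤1+f = begin
    valAux (suc f) p (p ^ suc e * m)    ≡⟨ cong (valAux (suc f) p) (*-assoc p (p ^ e) m) ⟩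
    valAux (suc f) p (p * (p ^ e * m))  ≡⟨ valAux-p* f ⟩
    suc (valAux f p (p ^ e * m))        ≡⟨ cong suc (valAux-p^e*m e p∤m (<⇒≤pred (<-≤-trans p^e*m<p^[1+e]*m ≤1+f))) ⟩
    suc e                               ∎
    where open ≡-Reasoning

valℕ-p^e*m : ∀ {p} .{{_ : NonTrivial p}} e {m} → ¬ p ∣ m → valℕ p (p ^ e * m) ≡ e
valℕ-p^e*m e p∤m = valAux-p^e*m e p∤m ≤-refl

p-adic-split : ∀ {p} .{{_ : NonTrivial p}} n → 0 < n → ∃₂ λ e m → ¬ p ∣ m × n ≡ p ^ e * m
p-adic-split {p} = <-rec _ split
  where
  split : ∀ n → (∀ {k} → k < n → 0 < k → ∃₂ λ e m → ¬ p ∣ m × k ≡ p ^ e * m) → 0 < n →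
          ∃₂ λ e m → ¬ p ∣ m × n ≡ p ^ e * m
  split n rec 0<n with p ∣? n
  ... | no p∤n = 0 , n , p∤n , sym (*-identityˡ n)
  ... | yes (divides k refl) with rec k<k*p 0<k
    where
    instance _ = >-nonZero 0<n
    0<k : 0 < k
    0<k = >-nonZero⁻¹ k {{m*n≢0⇒m≢0 k}}
    k<k*p : k < k * p
    k<k*p = m<m*n k p {{>-nonZero 0<k}} (nonTrivial⇒n>1 p)
  ...   | e , m , p∤m , refl = suc e , m , p∤m , trans (*-comm (p ^ e * m) p) (sym (*-assoc p (p ^ e) m))

valℕ-* : ∀ {p} → Prime p → ∀ {a b} → 0 < a → 0 < b → valℕ p (a * b) ≡ valℕ p a + valℕ p b
valℕ-* {p} p-prime {a} {b} 0<a 0<b = multiplicative (p-adic-split a 0<a) (p-adic-split b 0<b)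
  where
  instance _ = prime⇒nonTrivial p-prime
  multiplicative : (∃₂ λ e m → ¬ p ∣ m × a ≡ p ^ e * m) → (∃₂ λ e m → ¬ p ∣ m × b ≡ p ^ e * m) →
                   valℕ p (a * b) ≡ valℕ p a + valℕ p b
  multiplicative (e₁ , m₁ , p∤m₁ , refl) (e₂ , m₂ , p∤m₂ , refl) = begin
    valℕ p (p ^ e₁ * m₁ * (p ^ e₂ * m₂))          ≡⟨ cong (valℕ p) (interchange (p ^ e₁) m₁ (p ^ e₂) m₂) ⟩
    valℕ p (p ^ e₁ * p ^ e₂ * (m₁ * m₂))          ≡⟨ cong (λ q → valℕ p (q * (m₁ * m₂))) (^-distribˡ-+-* p e₁ e₂) ⟨
    valℕ p (p ^ (e₁ + e₂) * (m₁ * m₂))            ≡⟨ valℕ-p^e*m (e₁ + e₂) p∤m₁*m₂ ⟩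
    e₁ + e₂                                       ≡⟨ cong₂ _+_ (valℕ-p^e*m e₁ p∤m₁) (valℕ-p^e*m e₂ p∤m₂) ⟨
    valℕ p (p ^ e₁ * m₁) + valℕ p (p ^ e₂ * m₂)   ∎
    where
    open ≡-Reasoning
    interchange : ∀ w x y z → w * x * (y * z) ≡ w * y * (x * z)
    interchange = solve-∀
    p∤m₁*m₂ : ¬ p ∣ m₁ * m₂
    p∤m₁*m₂ = [ p∤m₁ , p∤m₂ ]′ ∘ euclidsLemma m₁ m₂ p-prime

ordᵘ : ℕ → ℚᵘ → ℤ
ordᵘ p x = + valℕ p ℤ.∣ ℚᵘ.↥ x ∣ ℤ.- + valℕ p (ℚᵘ.↧ₙ x)

ord≡ordᵘ : ∀ p x → ord p x ≡ ordᵘ p (toℚᵘ x)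
ord≡ordᵘ p (mkℚ _ _ _) = refl

m+q≡o+n⇒m-n≡o-q : ∀ m n o q → m + q ≡ o + n → + m ℤ.- + n ≡ + o ℤ.- + q
m+q≡o+n⇒m-n≡o-q m n o q m+q≡o+n = begin
  + m ℤ.- + n                         ≡⟨ add-q (+ m) (+ n) (+ q) ⟩
  (+ m ℤ.+ + q) ℤ.- + q ℤ.- + n       ≡⟨ cong (λ x → + x ℤ.- + q ℤ.- + n) m+q≡o+n ⟩
  (+ o ℤ.+ + n) ℤ.- + q ℤ.- + n       ≡⟨ cancel-n (+ o) (+ n) (+ q) ⟩
  + o ℤ.- + q                         ∎
  where
  open ≡-Reasoning
  add-q : ∀ m n q → m ℤ.- n ≡ (m ℤ.+ q) ℤ.- q ℤ.- n
  add-q = ℤ.solve-∀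
  cancel-n : ∀ o n q → (o ℤ.+ n) ℤ.- q ℤ.- n ≡ o ℤ.- q
  cancel-n = ℤ.solve-∀

ordᵘ-cong : ∀ {p} → Prime p → ∀ {x y} → x ≃ y → ℤ.∣ ℚᵘ.↥ x ∣ ≢ 0 → ordᵘ p x ≡ ordᵘ p y
ordᵘ-cong {p} p-prime {mkℚᵘ n₁ d₁} {mkℚᵘ n₂ d₂} (*≡* n₁d₂≡n₂d₁) n₁≢0 =
  m+q≡o+n⇒m-n≡o-q _ (valℕ p (suc d₁)) _ (valℕ p (suc d₂)) (begin
    valℕ p ℤ.∣ n₁ ∣ + valℕ p (suc d₂)  ≡⟨ valℕ-* p-prime (n≢0⇒n>0 n₁≢0) z<s ⟨
    valℕ p (ℤ.∣ n₁ ∣ * suc d₂)         ≡⟨ cong (valℕ p) ∣n₁∣d₂≡∣n₂∣d₁ ⟩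
    valℕ p (ℤ.∣ n₂ ∣ * suc d₁)         ≡⟨ valℕ-* p-prime (n≢0⇒n>0 n₂≢0) z<s ⟩
    valℕ p ℤ.∣ n₂ ∣ + valℕ p (suc d₁)  ∎)
  where
  open ≡-Reasoning
  ∣n₁∣d₂≡∣n₂∣d₁ : ℤ.∣ n₁ ∣ * suc d₂ ≡ ℤ.∣ n₂ ∣ * suc d₁
  ∣n₁∣d₂≡∣n₂∣d₁ = trans (sym (ℤ.abs-* n₁ (+ suc d₂))) (trans (cong ℤ.∣_∣ n₁d₂≡n₂d₁) (ℤ.abs-* n₂ (+ suc d₁)))
  n₂≢0 : ℤ.∣ n₂ ∣ ≢ 0
  n₂≢0 n₂≡0 = n₁≢0 (m*n≡0⇒m≡0 ℤ.∣ n₁ ∣ (suc d₂) (trans ∣n₁∣d₂≡∣n₂∣d₁ (cong (_* suc d₁) n₂≡0)))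

ord-* : ∀ {p} → Prime p → ∀ x y .{{_ : Positive x}} .{{_ : Positive y}} →
        ord p (x ℚ.* y) ≡ ord p x ℤ.+ ord p y
ord-* {p} p-prime x@(mkℚ +[1+ n₁ ] d₁ _) y@(mkℚ +[1+ n₂ ] d₂ _) = begin
  ord p (x ℚ.* y)                              ≡⟨ ord≡ordᵘ p (x ℚ.* y) ⟩
  ordᵘ p (toℚᵘ (x ℚ.* y))                      ≡⟨ ordᵘ-cong p-prime (ℚᵘ.≃-sym (ℚ.toℚᵘ-homo-* x y)) (λ ()) ⟨
  ordᵘ p (toℚᵘ x ℚᵘ.* toℚᵘ y)                  ≡⟨ cong₂ (λ a b → + a ℤ.- + b) (valℕ-* p-prime z<s z<s) (valℕ-* p-prime z<s z<s) ⟩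
  (+ N₁ ℤ.+ + N₂) ℤ.- (+ D₁ ℤ.+ + D₂)          ≡⟨ interchange (+ N₁) (+ N₂) (+ D₁) (+ D₂) ⟩
  ord p x ℤ.+ ord p y                          ∎
  where
  open ≡-Reasoning
  N₁ N₂ D₁ D₂ : ℕ
  N₁ = valℕ p (suc n₁); N₂ = valℕ p (suc n₂); D₁ = valℕ p (suc d₁); D₂ = valℕ p (suc d₂)
  interchange : ∀ a b c d → (a ℤ.+ b) ℤ.- (c ℤ.+ d) ≡ (a ℤ.- c) ℤ.+ (b ℤ.- d)
  interchange = ℤ.solve-∀

ord-inv : ∀ p x .{{_ : Positive x}} → ord p (inv x) ≡ ℤ.- ord p x
ord-inv p (mkℚ +[1+ n ] d _) = swap (+ valℕ p (suc n)) (+ valℕ p (suc d))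
  where
  swap : ∀ a b → b ℤ.- a ≡ ℤ.- (a ℤ.- b)
  swap = ℤ.solve-∀

inv-pos : ∀ x .{{_ : Positive x}} → Positive (inv x)
inv-pos (mkℚ +[1+ _ ] _ _) = _

pos+ℕ-pos : ∀ x .{{_ : Positive x}} j → Positive (x ℚ.+ + j ℚ./ 1)
pos+ℕ-pos x j = ℚ.pos+nonNeg⇒pos x (+ j ℚ./ 1) {{ℚ.normalize-nonNeg j 1}}

poch-pos : ∀ x .{{_ : Positive x}} k → Positive (poch x k)
poch-pos x zero = _
poch-pos x (suc k) = ℚ.pos*pos⇒pos (poch x k) {{poch-pos x k}} (x ℚ.+ + k ℚ./ 1) {{pos+ℕ-pos x k}}

-- + a / 1 unfolds to fromℚᵘ (mkℚᵘ (+ a) 0).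
ℕ/1≃ : ∀ a → toℚᵘ (+ a ℚ./ 1) ≃ mkℚᵘ (+ a) 0
ℕ/1≃ a = ℚ.toℚᵘ-fromℚᵘ (mkℚᵘ (+ a) 0)

ℕ/1-cancel-≤ : ∀ {a b} → + a ℚ./ 1 ℚ.≤ + b ℚ./ 1 → a ≤ b
ℕ/1-cancel-≤ {a} {b} a≤b = ℤ.drop‿+≤+ (subst₂ ℤ._≤_ (ℤ.*-identityʳ (+ a)) (ℤ.*-identityʳ (+ b))
  (ℚᵘ.drop-*≤* (ℚᵘ.≤-respʳ-≃ (ℕ/1≃ b) (ℚᵘ.≤-respˡ-≃ (ℕ/1≃ a) (ℚ.toℚᵘ-mono-≤ a≤b)))))

ℕ/1-cancel-< : ∀ {a b} → + a ℚ./ 1 ℚ.< + b ℚ./ 1 → a < b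
ℕ/1-cancel-< {a} {b} a<b = ℤ.drop‿+<+ (subst₂ ℤ._<_ (ℤ.*-identityʳ (+ a)) (ℤ.*-identityʳ (+ b))
  (ℚᵘ.drop-*<* (ℚᵘ.<-respʳ-≃ (ℕ/1≃ b) (ℚᵘ.<-respˡ-≃ (ℕ/1≃ a) (ℚ.toℚᵘ-mono-< a<b)))))

ℕ/1-injective : ∀ {a b} → + a ℚ./ 1 ≡ + b ℚ./ 1 → a ≡ b
ℕ/1-injective a≡b = ≤-antisym (ℕ/1-cancel-≤ (ℚ.≤-reflexive a≡b)) (ℕ/1-cancel-≤ (ℚ.≤-reflexive (sym a≡b)))

-- Fermat's little theorem

prime∤! : ∀ {p m} → Prime p → m < p → ¬ p ∣ m !
prime∤! {m = zero} p-prime _ p∣1 = ¬prime[1] (subst Prime (∣1⇒≡1 p∣1) p-prime)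
prime∤! {m = suc m} p-prime m<p p∣m! with euclidsLemma (suc m) (m !) p-prime p∣m!
... | inj₁ p∣1+m = >⇒∤ m<p p∣1+m
... | inj₂ p∣m! = prime∤! p-prime (<-trans (n<1+n m) m<p) p∣m!

prime∣pCk : ∀ {p k} → Prime p → 0 < k → k < p → p ∣ p C k
prime∣pCk {p@(suc q)} {k} p-prime 0<k k<p =
  [ id , flip contradiction p∤k!*[p-k]! ]′ (euclidsLemma (p C k) (k ! * (p ∸ k) !) p-prime p∣pCk*k!*[p-k]!)
  where
  instance _ = k !* (p ∸ k) !≢0
  p∤k!*[p-k]! : ¬ p ∣ k ! * (p ∸ k) !
  p∤k!*[p-k]! = [ prime∤! p-prime k<p , prime∤! p-prime (∸-monoʳ-< 0<k (<⇒≤ k<p)) ]′ ∘ euclidsLemma (k !) ((p ∸ k) !) p-prime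
  p∣pCk*k!*[p-k]! : p ∣ (p C k) * (k ! * (p ∸ k) !)
  p∣pCk*k!*[p-k]! = subst (p ∣_) (begin
    p !                                              ≡⟨ m/n*n≡m (k![n∸k]!∣n! (<⇒≤ k<p)) ⟨
    p ! / (k ! * (p ∸ k) !) * (k ! * (p ∸ k) !)      ≡⟨ cong (_* (k ! * (p ∸ k) !)) (nCk≡n!/k![n-k]! (<⇒≤ k<p)) ⟨
    (p C k) * (k ! * (p ∸ k) !)                      ∎) (m∣m*n (q !))
    where open ≡-Reasoning

semiring-^≡^ : ∀ a n → a Semiring.^ n ≡ a ^ n
semiring-^≡^ a zero = refl
semiring-^≡^ a (suc n) = cong (a *_) (semiring-^≡^ a n)

monoid-×≡* : ∀ n a → n Monoid.× a ≡ n * a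
monoid-×≡* zero a = refl
monoid-×≡* (suc n) a = cong (_+_ a) (monoid-×≡* n a)

binomial-theorem : ∀ n a → (a + 1) ^ n ≡ ∑ (λ (k : Fin (suc n)) → (n C toℕ k) * a ^ toℕ k)
binomial-theorem n a = begin
  (a + 1) ^ n                                          ≡⟨ semiring-^≡^ (a + 1) n ⟨
  (a + 1) Semiring.^ n                                 ≡⟨ Binomial.theorem n a 1 ⟩
  ∑ (binomialTerm a 1 n)                               ≡⟨ sum-cong-≗ {suc n} term-agrees ⟩
  ∑ (λ (k : Fin (suc n)) → (n C toℕ k) * a ^ toℕ k)    ∎
  where
  open ≡-Reasoning
  term-agrees : ∀ k → binomialTerm a 1 n k ≡ (n C toℕ k) * a ^ toℕ k
  term-agrees k = begin
    (n C toℕ k) Monoid.× (a Semiring.^ toℕ k * 1 Semiring.^ (n ∸ toℕ k))  ≡⟨ monoid-×≡* (n C toℕ k) _ ⟩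
    (n C toℕ k) * (a Semiring.^ toℕ k * 1 Semiring.^ (n ∸ toℕ k))         ≡⟨ cong₂ (λ x y → (n C toℕ k) * (x * y)) (semiring-^≡^ a (toℕ k)) 1^n≡1 ⟩
    (n C toℕ k) * (a ^ toℕ k * 1)                                          ≡⟨ cong ((n C toℕ k) *_) (*-identityʳ (a ^ toℕ k)) ⟩
    (n C toℕ k) * a ^ toℕ k                                                ∎
    where
    1^n≡1 : 1 Semiring.^ (n ∸ toℕ k) ≡ 1
    1^n≡1 = trans (semiring-^≡^ 1 (n ∸ toℕ k)) (^-zeroˡ (n ∸ toℕ k))

∣-∑ : ∀ {d n} (t : Vector ℕ n) → (∀ i → d ∣ t i) → d ∣ ∑ t
∣-∑ {n = zero} t _ = _ ∣0
∣-∑ {n = suc n} t d∣t = ∣m∣n⇒∣m+n (d∣t 0F) (∣-∑ (t ∘ sucF) (d∣t ∘ sucF))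

frobenius : ∀ {p} .{{_ : NonZero p}} a → Prime p → (a + 1) ^ p % p ≡ (a ^ p + 1) % p
frobenius {p@(suc q)} a p-prime = begin
  (a + 1) ^ p % p                  ≡⟨ cong (_% p) expansion ⟩
  (1 + (middle + a ^ p)) % p       ≡⟨ cong (_% p) (rearrange middle (a ^ p)) ⟩
  (a ^ p + 1 + middle) % p         ≡⟨ %-remove-+ʳ (a ^ p + 1) (∣-∑ _ p∣middle) ⟩
  (a ^ p + 1) % p                  ∎
  where
  open ≡-Reasoning
  t : Vector ℕ (suc p)
  t k = (p C toℕ k) * a ^ toℕ k
  middle : ℕ
  middle = ∑ (init (t ∘ sucF))
  rearrange : ∀ m x → 1 + (m + x) ≡ x + 1 + m
  rearrange = solve-∀
  p∣middle : ∀ i → p ∣ init (t ∘ sucF) i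
  p∣middle i = ∣m⇒∣m*n (a ^ suc (toℕ (inject₁ i)))
    (prime∣pCk p-prime z<s (subst (_< p) (sym (cong suc (toℕ-inject₁ i))) (s<s (toℕ<n i))))
  expansion : (a + 1) ^ p ≡ 1 + (middle + a ^ p)
  expansion = begin
    (a + 1) ^ p                          ≡⟨ binomial-theorem p a ⟩
    t 0F + ∑ (t ∘ sucF)                  ≡⟨ cong (_+_ (t 0F)) (sum-init-last (t ∘ sucF)) ⟩
    1 + (middle + t (sucF (fromℕ q)))    ≡⟨ cong (λ k → 1 + (middle + (p C k) * a ^ k)) (cong suc (toℕ-fromℕ q)) ⟩
    1 + (middle + (p C p) * a ^ p)       ≡⟨ cong (λ c → 1 + (middle + c * a ^ p)) (nCn≡1 p) ⟩
    1 + (middle + 1 * a ^ p)             ≡⟨ cong (λ x → 1 + (middle + x)) (*-identityˡ (a ^ p)) ⟩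
    1 + (middle + a ^ p)                 ∎

fermat : ∀ {p} .{{_ : NonZero p}} a → Prime p → a ^ p % p ≡ a % p
fermat {p@(suc _)} zero p-prime = refl
fermat {p} (suc a) p-prime = begin
  suc a ^ p % p                ≡⟨ cong (λ x → x ^ p % p) (+-comm 1 a) ⟩
  (a + 1) ^ p % p              ≡⟨ frobenius a p-prime ⟩
  (a ^ p + 1) % p              ≡⟨ %-distribˡ-+ (a ^ p) 1 p ⟩
  (a ^ p % p + 1 % p) % p      ≡⟨ cong (λ x → (x + 1 % p) % p) (fermat a p-prime) ⟩
  (a % p + 1 % p) % p          ≡⟨ %-distribˡ-+ a 1 p ⟨
  (a + 1) % p                  ≡⟨ cong (_% p) (+-comm a 1) ⟩
  suc a % p                    ∎
  where open ≡-Reasoning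

%≡%⇒∣∸ : ∀ {p} .{{_ : NonZero p}} x y → x % p ≡ y % p → p ∣ x ∸ y
%≡%⇒∣∸ {p} x y x%p≡y%p = divides (x / p ∸ y / p) (begin
  x ∸ y                                       ≡⟨ cong₂ _∸_ (m≡m%n+[m/n]*n x p) (m≡m%n+[m/n]*n y p) ⟩
  (x % p + x / p * p) ∸ (y % p + y / p * p)   ≡⟨ cong (λ r → (r + x / p * p) ∸ (y % p + y / p * p)) x%p≡y%p ⟩
  (y % p + x / p * p) ∸ (y % p + y / p * p)   ≡⟨ [m+n]∸[m+o]≡n∸o (y % p) _ _ ⟩
  x / p * p ∸ y / p * p                       ≡⟨ *-distribʳ-∸ p (x / p) (y / p) ⟨
  (x / p ∸ y / p) * p                         ∎)
  where open ≡-Reasoning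

fermat-unit : ∀ {p} .{{_ : NonZero p}} {a} → Prime p → ¬ p ∣ a → a ^ (p ∸ 1) % p ≡ 1
fermat-unit {p@(suc q)} {a} p-prime p∤a = begin
  a ^ q % p               ≡⟨ cong (_% p) (m∸n+n≡m (m^n>0 a q)) ⟨
  (a ^ q ∸ 1 + 1) % p     ≡⟨ %-remove-+ˡ 1 p∣a^q-1 ⟩
  1 % p                   ≡⟨ m<n⇒m%n≡m (nonTrivial⇒n>1 p) ⟩
  1                       ∎
  where
  open ≡-Reasoning
  instance
    _ = ∤⇒nonZero p∤a
    _ = prime⇒nonTrivial p-prime
  p∣a*[a^q-1] : p ∣ a * (a ^ q ∸ 1)
  p∣a*[a^q-1] = subst (p ∣_) (trans (cong (a * a ^ q ∸_) (sym (*-identityʳ a))) (sym (*-distribˡ-∸ a (a ^ q) 1)))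
                  (%≡%⇒∣∸ (a ^ p) a (fermat a p-prime))
  p∣a^q-1 : p ∣ a ^ q ∸ 1
  p∣a^q-1 = [ flip contradiction p∤a , id ]′ (euclidsLemma a (a ^ q ∸ 1) p-prime p∣a*[a^q-1])

-- Signed counts along sorted lists of tagged entries

step : ℚ × Bool → ℤ
step (_ , true) = + 1
step (_ , false) = -1ℤ

stepSum≡∑step : ∀ L → stepSum L ≡ foldr ℤ._+_ (+ 0) (map step L)
stepSum≡∑step [] = refl
stepSum≡∑step ((_ , true) ∷ L) = cong (ℤ._+_ (+ 1)) (stepSum≡∑step L)
stepSum≡∑step ((_ , false) ∷ L) = cong (ℤ._+_ -1ℤ) (stepSum≡∑step L)

stepSum-↭ : ∀ {xs ys} → xs ↭ ys → stepSum xs ≡ stepSum ys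
stepSum-↭ {xs} {ys} xs↭ys = begin
  stepSum xs                        ≡⟨ stepSum≡∑step xs ⟩
  foldr ℤ._+_ (+ 0) (map step xs)   ≡⟨ foldr-commMonoid (setoid ℤ) ℤ.+-0-isCommutativeMonoid (↭⇒↭ₛ (↭-map⁺ step xs↭ys)) ⟩
  foldr ℤ._+_ (+ 0) (map step ys)   ≡⟨ stepSum≡∑step ys ⟨
  stepSum ys                        ∎
  where open ≡-Reasoning

stepSum-++ : ∀ xs ys → stepSum (xs ++ ys) ≡ stepSum xs ℤ.+ stepSum ys
stepSum-++ [] ys = sym (ℤ.+-identityˡ (stepSum ys))
stepSum-++ ((_ , true) ∷ xs) ys = trans (cong ℤ.suc (stepSum-++ xs ys)) (sym (ℤ.+-assoc (+ 1) (stepSum xs) (stepSum ys)))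
stepSum-++ ((_ , false) ∷ xs) ys = trans (cong ℤ.pred (stepSum-++ xs ys)) (sym (ℤ.+-assoc -1ℤ (stepSum xs) (stepSum ys)))

module _ {ℓ} {P : ℚ → Set ℓ} (P? : Decidable P) where

  stepSum-filter-tagα : ∀ xs → stepSum (filter (P? ∘ proj₁) (tagα xs)) ≡ + length (filter P? xs)
  stepSum-filter-tagα [] = refl
  stepSum-filter-tagα (x ∷ xs) with P? x
  ... | yes _ = cong ℤ.suc (stepSum-filter-tagα xs)
  ... | no _ = stepSum-filter-tagα xs

  stepSum-filter-tagβ : ∀ xs → stepSum (filter (P? ∘ proj₁) (tagβ xs)) ≡ ℤ.- + length (filter P? xs)
  stepSum-filter-tagβ [] = refl
  stepSum-filter-tagβ (x ∷ xs) with P? x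
  ... | yes _ = trans (cong ℤ.pred (stepSum-filter-tagβ xs)) (sym (ℤ.neg-suc _))
  ... | no _ = stepSum-filter-tagβ xs

mu-∷ : ∀ e L i → mu (e ∷ L) (suc (suc i)) ≡ mu L (suc i)
mu-∷ e L i with drop i L
... | [] = refl
... | _ ∷ _ = refl

mu-All : ∀ {ℓ} {Q : ℚ → Set ℓ} {L} i → All (Q ∘ proj₁) L → i < length L → Q (mu L (suc i))
mu-All {L = _ ∷ _} zero (q ∷ _) _ = q
mu-All {Q = Q} {e ∷ L} (suc i) (_ ∷ qs) (s<s i<n) = subst Q (sym (mu-∷ e L i)) (mu-All i qs i<n)

module _ (κ : ℚ → ℕ) (κ0≡0 : κ 0ℚ ≡ 0) where

  filter-below≡take : ∀ {k} L i → AllPairs (_≤_ on (κ ∘ proj₁)) L → i < length L →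
                      κ (mu L i) < k → k ≤ κ (mu L (suc i)) → filter (λ e → κ (proj₁ e) <? k) L ≡ take i L
  filter-below≡take {k} (e ∷ L) zero (e≤L ∷ _) _ _ k≤κe =
    filter-none (λ e → κ (proj₁ e) <? k) (≤⇒≯ k≤κe ∷ All.map (≤⇒≯ ∘ ≤-trans k≤κe) e≤L)
  filter-below≡take {k} (e ∷ L) (suc i) (e≤L ∷ L-sorted) (s<s i<n) κμᵢ<k k≤κμᵢ₊₁ =
    trans (filter-accept (λ e → κ (proj₁ e) <? k) κe<k)
          (cong (e ∷_) (filter-below≡take L i L-sorted i<n (drop-head i κμᵢ<k) (subst (λ x → k ≤ κ x) (mu-∷ e L i) k≤κμᵢ₊₁)))
    where
    κe<k : κ (proj₁ e) < k
    κe<k = ≤-<-trans (mu-All i (≤-refl ∷ e≤L) (m<n⇒m<1+n i<n)) κμᵢ<k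
    drop-head : ∀ j → κ (mu (e ∷ L) (suc j)) < k → κ (mu L j) < k
    drop-head zero _ = subst (_< k) (sym κ0≡0) (≤-<-trans z≤n κe<k)
    drop-head (suc j) κμ<k = subst (λ x → κ x < k) (mu-∷ e L j) κμ<k

Linked-mono : ∀ {a p r s} {A : Set a} {P : A → Set p} {R : A → A → Set r} {S : A → A → Set s} →
              (∀ {x y} → P x → P y → R x y → S x y) → ∀ {xs} → All P xs → Linked R xs → Linked S xs
Linked-mono f [] [] = []
Linked-mono f (_ ∷ []) [-] = [-]
Linked-mono f (px ∷ py ∷ pxs) (Rxy ∷ Rxs) = f px py Rxy ∷ Linked-mono f (py ∷ pxs) Rxs

TagLe⇒≤ : ∀ {e f} → TagLe e f → proj₁ e ℚ.≤ proj₁ f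
TagLe⇒≤ (lt x<y) = ℚ.<⇒≤ x<y
TagLe⇒≤ (eq _) = ℚ.≤-refl

-- First digits and valuations of Pochhammer symbols

prime∣-unique-≤ : ∀ {p} → Prime p → ∀ {n d j c} → ¬ p ∣ d → j ≤ c → c < p →
                  p ∣ n + j * d → p ∣ n + c * d → j ≡ c
prime∣-unique-≤ {p} p-prime {n} {d} {j} {c} p∤d j≤c c<p p∣n+jd p∣n+cd =
  [ j≡c , flip contradiction p∤d ]′ (euclidsLemma (c ∸ j) d p-prime p∣[c-j]d)
  where
  open ≡-Reasoning
  n+cd≡n+jd+[c-j]d : n + c * d ≡ n + j * d + (c ∸ j) * d
  n+cd≡n+jd+[c-j]d = begin
    n + c * d                    ≡⟨ cong (λ x → n + x * d) (m+[n∸m]≡n j≤c) ⟨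
    n + (j + (c ∸ j)) * d        ≡⟨ distrib n j (c ∸ j) d ⟩
    n + j * d + (c ∸ j) * d      ∎
    where
    distrib : ∀ n j k d → n + (j + k) * d ≡ n + j * d + k * d
    distrib = solve-∀
  p∣[c-j]d : p ∣ (c ∸ j) * d
  p∣[c-j]d = ∣m+n∣m⇒∣n (subst (p ∣_) n+cd≡n+jd+[c-j]d p∣n+cd) p∣n+jd
  j≡c : p ∣ c ∸ j → j ≡ c
  j≡c p∣c-j with c ∸ j in c-j≡
  ... | zero = ≤-antisym j≤c (m∸n≡0⇒m≤n c-j≡)
  ... | suc _ = contradiction p∣c-j (>⇒∤ (≤-<-trans (subst (_≤ c) c-j≡ (m∸n≤m c j)) c<p))

prime∣-unique : ∀ {p} → Prime p → ∀ {n d j c} → ¬ p ∣ d → j < p → c < p →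
                p ∣ n + j * d → p ∣ n + c * d → j ≡ c
prime∣-unique p-prime {j = j} {c} p∤d j<p c<p p∣n+jd p∣n+cd with ≤-total j c
... | inj₁ j≤c = prime∣-unique-≤ p-prime p∤d j≤c c<p p∣n+jd p∣n+cd
... | inj₂ c≤j = sym (prime∣-unique-≤ p-prime p∤d c≤j j<p p∣n+cd p∣n+jd)

-[1+n]%ℕm≡m∸[1+n] : ∀ n m .{{_ : NonZero m}} → suc n < m → -[1+ n ] ℤ.%ℕ m ≡ m ∸ suc n
-[1+n]%ℕm≡m∸[1+n] n m 1+n<m with suc n % m | m<n⇒m%n≡m 1+n<m
... | .(suc n) | refl = refl

lcd-dvd : ∀ xs → All (λ x → denominatorℕ x ∣ lcd xs) xs
lcd-dvd [] = []
lcd-dvd (x ∷ xs) = m∣lcm[m,n] (denominatorℕ x) (lcd xs) ∷ All.map (flip ∣-trans (n∣lcm[m,n] (denominatorℕ x) (lcd xs))) (lcd-dvd xs)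

module _ {p-2 : ℕ} (p-prime : Prime (2+ p-2)) where

  p : ℕ
  p = 2+ p-2

  [-_]₀ : ℚ → ℕ
  [- x ]₀ = digit0 p (ℚ.- x)

  [-_]₀<?_ : ∀ x k → Dec ([- x ]₀ < k)
  [- x ]₀<? k = [- x ]₀ <? k

  [-]₀<p : ∀ x → [- x ]₀ < p
  [-]₀<p x = m%n<n ((numerator (ℚ.- x) ℤ.%ℕ p) * denominatorℕ (ℚ.- x) ^ p-2) p

  module Fraction {n-1 d-1 : ℕ} .(coprime : Coprime (suc n-1) (suc d-1)) {e : ℕ}
                  (n≤d : suc n-1 ≤ suc d-1) (p-1≡e*d : p ∸ 1 ≡ e * suc d-1) where

    n d c : ℕ
    n = suc n-1
    d = suc d-1
    c = n * e

    x : ℚ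
    x = mkℚ +[1+ n-1 ] d-1 coprime

    d<p : d < p
    d<p = s<s (≤-trans (m≤n*m d e {{≢-nonZero λ { refl → 0≢1+n (sym p-1≡e*d) }}}) (≤-reflexive (sym p-1≡e*d)))

    n<p : n < p
    n<p = ≤-<-trans n≤d d<p

    c<p : c < p
    c<p = s<s (≤-trans (*-monoˡ-≤ e n≤d) (≤-reflexive (trans (*-comm d e) (sym p-1≡e*d))))

    p∤d : ¬ p ∣ d
    p∤d = >⇒∤ d<p

    n+c*d≡n*p : n + c * d ≡ n * p
    n+c*d≡n*p = begin
      n + n * e * d      ≡⟨ cong (_+_ n) (*-assoc n e d) ⟩
      n + n * (e * d)    ≡⟨ cong (λ m → n + n * m) p-1≡e*d ⟨
      n + n * (p ∸ 1)      ≡⟨ *-suc n (p ∸ 1) ⟨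
      n * p              ∎
      where open ≡-Reasoning

    -- p − n ≡ c·d (mod p) because n + c·d = n·p, and d^(p−1) ≡ 1 (mod p).
    [-x]₀≡c : [- x ]₀ ≡ c
    [-x]₀≡c = begin
      ((-[1+ n-1 ] ℤ.%ℕ p) * d ^ p-2) % p     ≡⟨ cong (λ t → (t * d ^ p-2) % p) (-[1+n]%ℕm≡m∸[1+n] n-1 p n<p) ⟩
      ((p ∸ n) * d ^ p-2) % p                  ≡⟨ %-distribˡ-* (p ∸ n) (d ^ p-2) p ⟩
      ((p ∸ n) % p * (d ^ p-2 % p)) % p        ≡⟨ cong (λ t → (t * (d ^ p-2 % p)) % p) p-n≡c*d ⟩
      ((c * d) % p * (d ^ p-2 % p)) % p        ≡⟨ %-distribˡ-* (c * d) (d ^ p-2) p ⟨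
      (c * d * d ^ p-2) % p                    ≡⟨ cong (_% p) (*-assoc c d (d ^ p-2)) ⟩
      (c * d ^ (p ∸ 1)) % p                    ≡⟨ %-distribˡ-* c (d ^ (p ∸ 1)) p ⟩
      (c % p * (d ^ (p ∸ 1) % p)) % p          ≡⟨ cong (λ t → (c % p * t) % p) (fermat-unit p-prime p∤d) ⟩
      (c % p * 1) % p                        ≡⟨ cong (_% p) (*-identityʳ (c % p)) ⟩
      c % p % p                              ≡⟨ m%n%n≡m%n c p ⟩
      c % p                                  ≡⟨ m<n⇒m%n≡m c<p ⟩
      c                                      ∎
      where
      open ≡-Reasoning
      p-n≡c*d : (p ∸ n) % p ≡ (c * d) % p
      p-n≡c*d = begin
        (p ∸ n) % p                     ≡⟨ [m+kn]%n≡m%n (p ∸ n) n p ⟨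
        (p ∸ n + n * p) % p             ≡⟨ cong (λ m → (p ∸ n + m) % p) n+c*d≡n*p ⟨
        (p ∸ n + (n + c * d)) % p       ≡⟨ cong (_% p) (+-assoc (p ∸ n) n (c * d)) ⟨
        (p ∸ n + n + c * d) % p         ≡⟨ cong (λ m → (m + c * d) % p) (m∸n+n≡m (<⇒≤ n<p)) ⟩
        (p + c * d) % p                 ≡⟨ cong (_% p) (+-comm p (c * d)) ⟩
        (c * d + p) % p                 ≡⟨ [m+n]%n≡m%n (c * d) p ⟩
        (c * d) % p                     ∎

    ord-x+j : ∀ j → ord p (x ℚ.+ + j ℚ./ 1) ≡ + valℕ p (n + j * d)
    ord-x+j j = begin
      ord p (x ℚ.+ + j ℚ./ 1)                           ≡⟨ ord≡ordᵘ p (x ℚ.+ + j ℚ./ 1) ⟩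
      ordᵘ p (toℚᵘ (x ℚ.+ + j ℚ./ 1))                   ≡⟨ ordᵘ-cong p-prime (ℚᵘ.≃-sym x+j≃) ∣numerator∣≢0 ⟨
      ordᵘ p (toℚᵘ x ℚᵘ.+ mkℚᵘ (+ j) 0)                 ≡⟨ cong₂ (λ a b → + valℕ p a ℤ.- + valℕ p b) ∣numerator∣ (*-identityʳ d) ⟩
      + valℕ p (n + j * d) ℤ.- + valℕ p d               ≡⟨ cong (λ v → + valℕ p (n + j * d) ℤ.- + v) (valAux-∤ d p∤d) ⟩
      + valℕ p (n + j * d) ℤ.- + 0                      ≡⟨ ℤ.+-identityʳ _ ⟩
      + valℕ p (n + j * d)                              ∎
      where
      open ≡-Reasoning
      ∣numerator∣ : ℤ.∣ ℚᵘ.↥ (toℚᵘ x ℚᵘ.+ mkℚᵘ (+ j) 0) ∣ ≡ n + j * d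
      ∣numerator∣ = begin
        ℤ.∣ + n ℤ.* + 1 ℤ.+ + j ℤ.* + d ∣      ≡⟨ cong₂ (λ a b → ℤ.∣ a ℤ.+ b ∣) (ℤ.pos-* n 1) (ℤ.pos-* j d) ⟨
        ℤ.∣ + (n * 1) ℤ.+ + (j * d) ∣          ≡⟨ cong ℤ.∣_∣ (ℤ.pos-+ (n * 1) (j * d)) ⟨
        n * 1 + j * d                          ≡⟨ cong (_+ j * d) (*-identityʳ n) ⟩
        n + j * d                              ∎
      ∣numerator∣≢0 : ℤ.∣ ℚᵘ.↥ (toℚᵘ x ℚᵘ.+ mkℚᵘ (+ j) 0) ∣ ≢ 0
      ∣numerator∣≢0 ∣numerator∣≡0 = 0≢1+n (trans (sym ∣numerator∣≡0) ∣numerator∣)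
      x+j≃ : toℚᵘ (x ℚ.+ + j ℚ./ 1) ≃ toℚᵘ x ℚᵘ.+ mkℚᵘ (+ j) 0
      x+j≃ = ℚᵘ.≃-trans (ℚ.toℚᵘ-homo-+ x (+ j ℚ./ 1)) (ℚᵘ.+-congʳ (toℚᵘ x) (ℕ/1≃ j))

    ord-x+c : ord p (x ℚ.+ + c ℚ./ 1) ≡ + 1
    ord-x+c = begin
      ord p (x ℚ.+ + c ℚ./ 1)      ≡⟨ ord-x+j c ⟩
      + valℕ p (n + c * d)         ≡⟨ cong (+_ ∘ valℕ p) (trans n+c*d≡n*p (*-comm n p)) ⟩
      + valℕ p (p * n)             ≡⟨ cong (+_ ∘ valℕ p ∘ (_* n)) (*-identityʳ p) ⟨
      + valℕ p (p ^ 1 * n)         ≡⟨ cong +_ (valℕ-p^e*m 1 (>⇒∤ n<p)) ⟩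
      + 1                          ∎
      where open ≡-Reasoning

    ord-x+j≢c : ∀ {j} → j < p → j ≢ c → ord p (x ℚ.+ + j ℚ./ 1) ≡ + 0
    ord-x+j≢c {j} j<p j≢c = trans (ord-x+j j) (cong +_ (valAux-∤ (n + j * d) (j≢c ∘ p∣n+j*d⇒j≡c)))
      where
      p∣n+j*d⇒j≡c : p ∣ n + j * d → j ≡ c
      p∣n+j*d⇒j≡c p∣n+jd = prime∣-unique p-prime p∤d j<p c<p p∣n+jd (subst (p ∣_) (sym n+c*d≡n*p) (n∣m*n n))

    ord-poch-suc : ∀ k → ord p (poch x (suc k)) ≡ ord p (poch x k) ℤ.+ ord p (x ℚ.+ + k ℚ./ 1)
    ord-poch-suc k = ord-* p-prime (poch x k) (x ℚ.+ + k ℚ./ 1) {{poch-pos x k}} {{pos+ℕ-pos x k}}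

    ord-poch-≤ : ∀ {k} → k ≤ c → ord p (poch x k) ≡ + 0
    ord-poch-≤ {zero} _ = refl
    ord-poch-≤ {suc k} k<c = begin
      ord p (poch x (suc k))                             ≡⟨ ord-poch-suc k ⟩
      ord p (poch x k) ℤ.+ ord p (x ℚ.+ + k ℚ./ 1)       ≡⟨ cong₂ ℤ._+_ (ord-poch-≤ (<⇒≤ k<c)) (ord-x+j≢c (<-trans k<c c<p) (<⇒≢ k<c)) ⟩
      + 0                                                ∎
      where open ≡-Reasoning

    ord-poch-> : ∀ {k} → c < k → k ≤ p → ord p (poch x k) ≡ + 1
    ord-poch-> {suc k} c<1+k 1+k≤p with m≤n⇒m<n∨m≡n (≤-pred c<1+k)
    ... | inj₁ c<k = begin
      ord p (poch x (suc k))                             ≡⟨ ord-poch-suc k ⟩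
      ord p (poch x k) ℤ.+ ord p (x ℚ.+ + k ℚ./ 1)       ≡⟨ cong₂ ℤ._+_ (ord-poch-> c<k (<⇒≤ 1+k≤p)) (ord-x+j≢c 1+k≤p (≢-sym (<⇒≢ c<k))) ⟩
      + 1                                                ∎
      where open ≡-Reasoning
    ... | inj₂ refl = begin
      ord p (poch x (suc c))                             ≡⟨ ord-poch-suc c ⟩
      ord p (poch x c) ℤ.+ ord p (x ℚ.+ + c ℚ./ 1)       ≡⟨ cong₂ ℤ._+_ (ord-poch-≤ ≤-refl) ord-x+c ⟩
      + 1                                                ∎
      where open ≡-Reasoning

    c/1≃x*[p-1] : mkℚᵘ (+ c) 0 ≃ toℚᵘ x ℚᵘ.* mkℚᵘ (+ (p ∸ 1)) 0
    c/1≃x*[p-1] = *≡* (begin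
      + c ℤ.* ℚᵘ.↧ (toℚᵘ x ℚᵘ.* mkℚᵘ (+ (p ∸ 1)) 0)  ≡⟨ cong (+ c ℤ.*_) (ℚᵘ.↧[n/d]≡d (+ n ℤ.* + (p ∸ 1)) (d * 1)) ⟩
      + c ℤ.* + (d * 1)                          ≡⟨ ℤ.pos-* c (d * 1) ⟨
      + (c * (d * 1))                            ≡⟨ cong +_ c*d≡n*[p-1] ⟩
      + (n * (p ∸ 1) * 1)                          ≡⟨ trans (ℤ.pos-* (n * (p ∸ 1)) 1) (cong (ℤ._* + 1) (ℤ.pos-* n (p ∸ 1))) ⟩
      + n ℤ.* + (p ∸ 1) ℤ.* + 1                    ∎)
      where
      open ≡-Reasoning
      c*d≡n*[p-1] : c * (d * 1) ≡ n * (p ∸ 1) * 1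
      c*d≡n*[p-1] = begin
        c * (d * 1)       ≡⟨ cong (c *_) (*-identityʳ d) ⟩
        n * e * d         ≡⟨ *-assoc n e d ⟩
        n * (e * d)       ≡⟨ cong (n *_) p-1≡e*d ⟨
        n * (p ∸ 1)         ≡⟨ *-identityʳ (n * (p ∸ 1)) ⟨
        n * (p ∸ 1) * 1     ∎

    c≡x*[p-1] : + c ℚ./ 1 ≡ x ℚ.* (+ (p ∸ 1) ℚ./ 1)
    c≡x*[p-1] = ℚ.toℚᵘ-injective (begin
      toℚᵘ (+ c ℚ./ 1)                       ≈⟨ ℕ/1≃ c ⟩
      mkℚᵘ (+ c) 0                           ≈⟨ c/1≃x*[p-1] ⟩
      toℚᵘ x ℚᵘ.* mkℚᵘ (+ (p ∸ 1)) 0           ≈⟨ ℚᵘ.*-congˡ {toℚᵘ x} (ℕ/1≃ (p ∸ 1)) ⟨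
      toℚᵘ x ℚᵘ.* toℚᵘ (+ (p ∸ 1) ℚ./ 1)       ≈⟨ ℚ.toℚᵘ-homo-* x (+ (p ∸ 1) ℚ./ 1) ⟨
      toℚᵘ (x ℚ.* (+ (p ∸ 1) ℚ./ 1))           ∎)
      where open ℚᵘ.≃-Reasoning

  data Admissible : ℚ → Set where
    fraction : ∀ {n-1 d-1 e} .{coprime : Coprime (suc n-1) (suc d-1)} →
               suc n-1 ≤ suc d-1 → p ∸ 1 ≡ e * suc d-1 → Admissible (mkℚ +[1+ n-1 ] d-1 coprime)

  admissible : ∀ {x} → 0ℚ ℚ.< x → x ℚ.≤ 1ℚ → denominatorℕ x ∣ p ∸ 1 → Admissible x
  admissible {mkℚ +[1+ n-1 ] d-1 _} _ (ℚ.*≤* (ℤ.+≤+ n*1≤d+0)) (divides e p-1≡e*d) =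
    fraction {e = e} (subst₂ _≤_ (cong suc (*-identityʳ n-1)) (cong suc (+-identityʳ d-1)) n*1≤d+0) p-1≡e*d
  admissible {mkℚ (+ 0) _ _} (ℚ.*<* (ℤ.+<+ ()))
  admissible {mkℚ -[1+ _ ] _ _} (ℚ.*<* ())

  admissible⇒pos : ∀ {x} → Admissible x → Positive x
  admissible⇒pos (fraction _ _) = _

  [-]₀-scaled : ∀ {x} → Admissible x → + [- x ]₀ ℚ./ 1 ≡ x ℚ.* (+ (p ∸ 1) ℚ./ 1)
  [-]₀-scaled (fraction {e = e} {coprime} n≤d p-1≡e*d) = trans (cong (λ k → + k ℚ./ 1) [-x]₀≡c) c≡x*[p-1]
    where open Fraction coprime {e} n≤d p-1≡e*d

  ord-poch-below : ∀ {x k} → Admissible x → [- x ]₀ < k → k ≤ p → ord p (poch x k) ≡ + 1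
  ord-poch-below {k = k} (fraction {e = e} {coprime} n≤d p-1≡e*d) x₀<k = ord-poch-> (subst (_< k) [-x]₀≡c x₀<k)
    where open Fraction coprime {e} n≤d p-1≡e*d

  ord-poch-above : ∀ {x k} → Admissible x → k ≤ [- x ]₀ → ord p (poch x k) ≡ + 0
  ord-poch-above {k = k} (fraction {e = e} {coprime} n≤d p-1≡e*d) k≤x₀ = ord-poch-≤ (subst (k ≤_) [-x]₀≡c k≤x₀)
    where open Fraction coprime {e} n≤d p-1≡e*d

  Admissible₀ : ℚ → Set
  Admissible₀ x = x ≡ 0ℚ ⊎ Admissible x

  [-]₀-scaled₀ : ∀ {x} → Admissible₀ x → + [- x ]₀ ℚ./ 1 ≡ x ℚ.* (+ (p ∸ 1) ℚ./ 1)
  [-]₀-scaled₀ (inj₁ refl) = sym (ℚ.*-zeroˡ (+ (p ∸ 1) ℚ./ 1))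
  [-]₀-scaled₀ (inj₂ x-adm) = [-]₀-scaled x-adm

  [-]₀-mono-≤ : ∀ {x y} → Admissible₀ x → Admissible₀ y → x ℚ.≤ y → [- x ]₀ ≤ [- y ]₀
  [-]₀-mono-≤ x-adm y-adm x≤y = ℕ/1-cancel-≤ (subst₂ ℚ._≤_ (sym ([-]₀-scaled₀ x-adm)) (sym ([-]₀-scaled₀ y-adm))
    (ℚ.*-monoʳ-≤-nonNeg (+ (p ∸ 1) ℚ./ 1) {{ℚ.normalize-nonNeg (p ∸ 1) 1}} x≤y))

  [-]₀-mono-< : ∀ {x y} → Admissible₀ x → Admissible₀ y → x ℚ.< y → [- x ]₀ < [- y ]₀
  [-]₀-mono-< x-adm y-adm x<y = ℕ/1-cancel-< (subst₂ ℚ._<_ (sym ([-]₀-scaled₀ x-adm)) (sym ([-]₀-scaled₀ y-adm))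
    (ℚ.*-monoˡ-<-pos (+ (p ∸ 1) ℚ./ 1) {{ℚ.normalize-pos (p ∸ 1) 1}} x<y))

  ∏poch-pos : ∀ {xs} k → All Admissible xs → Positive (prodℚ (map (λ a → poch a k) xs))
  ∏poch-pos k [] = _
  ∏poch-pos {x ∷ xs} k (x-adm ∷ xs-adm) =
    ℚ.pos*pos⇒pos (poch x k) {{poch-pos x {{admissible⇒pos x-adm}} k}} _ {{∏poch-pos k xs-adm}}

  ord-∏poch : ∀ {xs k} → All Admissible xs → k ≤ p →
              ord p (prodℚ (map (λ a → poch a k) xs)) ≡ + length (filter (λ a → [- a ]₀<? k) xs)
  ord-∏poch [] _ = refl
  ord-∏poch {x ∷ xs} {k} (x-adm ∷ xs-adm) k≤p = begin
    ord p (poch x k ℚ.* ∏xs)                                  ≡⟨ ord-* p-prime (poch x k) ∏xs {{poch-pos x {{admissible⇒pos x-adm}} k}} {{∏poch-pos k xs-adm}} ⟩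
    ord p (poch x k) ℤ.+ ord p ∏xs                            ≡⟨ cong (ℤ._+_ (ord p (poch x k))) (ord-∏poch xs-adm k≤p) ⟩
    ord p (poch x k) ℤ.+ + length (filter (λ a → [- a ]₀<? k) xs)
                                                              ≡⟨ split-head ⟩
    + length (filter (λ a → [- a ]₀<? k) (x ∷ xs))            ∎
    where
    open ≡-Reasoning
    ∏xs : ℚ
    ∏xs = prodℚ (map (λ a → poch a k) xs)
    split-head : ord p (poch x k) ℤ.+ + length (filter (λ a → [- a ]₀<? k) xs) ≡ + length (filter (λ a → [- a ]₀<? k) (x ∷ xs))
    split-head with [- x ]₀<? k
    ... | yes x₀<k = trans (cong (ℤ._+ + length (filter (λ a → [- a ]₀<? k) xs)) (ord-poch-below x-adm x₀<k k≤p))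
                           (cong (+_ ∘ length) (sym (filter-accept (λ a → [- a ]₀<? k) x₀<k)))
    ... | no x₀≮k = trans (cong (ℤ._+ + length (filter (λ a → [- a ]₀<? k) xs)) (ord-poch-above x-adm (≮⇒≥ x₀≮k)))
                          (cong (+_ ∘ length) (sym (filter-reject (λ a → [- a ]₀<? k) x₀≮k)))

  ord-A : ∀ {α β k} → All Admissible α → All Admissible β → k ≤ p →
          ord p (A α β k) ≡ stepSum (filter (λ e → [- proj₁ e ]₀<? k) (tagα α ++ tagβ β))
  ord-A {α} {β} {k} α-adm β-adm k≤p = begin
    ord p (∏α ℚ.* inv ∏β)                                       ≡⟨ ord-* p-prime ∏α (inv ∏β) {{∏poch-pos k α-adm}} {{inv-pos ∏β {{∏poch-pos k β-adm}}}} ⟩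
    ord p ∏α ℤ.+ ord p (inv ∏β)                                 ≡⟨ cong (ℤ._+_ (ord p ∏α)) (ord-inv p ∏β {{∏poch-pos k β-adm}}) ⟩
    ord p ∏α ℤ.- ord p ∏β                                       ≡⟨ cong₂ ℤ._-_ (ord-∏poch α-adm k≤p) (ord-∏poch β-adm k≤p) ⟩
    + length (filter below? α) ℤ.- + length (filter below? β)   ≡⟨ cong₂ ℤ._+_ (stepSum-filter-tagα below? α) (stepSum-filter-tagβ below? β) ⟨
    stepSum (filter (below? ∘ proj₁) (tagα α)) ℤ.+ stepSum (filter (below? ∘ proj₁) (tagβ β))
                                                                ≡⟨ stepSum-++ (filter (below? ∘ proj₁) (tagα α)) _ ⟨
    stepSum (filter (below? ∘ proj₁) (tagα α) ++ filter (below? ∘ proj₁) (tagβ β))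
                                                                ≡⟨ cong stepSum (filter-++ (below? ∘ proj₁) (tagα α) (tagβ β)) ⟨
    stepSum (filter (below? ∘ proj₁) (tagα α ++ tagβ β))        ∎
    where
    open ≡-Reasoning
    ∏α ∏β : ℚ
    ∏α = prodℚ (map (λ a → poch a k) α)
    ∏β = prodℚ (map (λ b → poch b k) β)
    below? : Decidable (λ a → [- a ]₀ < k)
    below? a = [- a ]₀<? k

  sorted-by-[-]₀ : ∀ {L} → All (Admissible ∘ proj₁) L → Linked TagLe L → AllPairs (_≤_ on ([-_]₀ ∘ proj₁)) L
  sorted-by-[-]₀ L-adm L-sorted =
    Linked⇒AllPairs ≤-trans (Linked-mono (λ e-adm f-adm e≤f → [-]₀-mono-≤ (inj₂ e-adm) (inj₂ f-adm) (TagLe⇒≤ e≤f)) L-adm L-sorted)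

  module Sorted {α β L} (α-adm : All Admissible α) (β-adm : All Admissible β)
                (L↭α+β : L ↭ tagα α ++ tagβ β) (L-sorted : Linked TagLe L) where

    L-adm : All (Admissible ∘ proj₁) L
    L-adm = All-resp-↭ (↭-sym L↭α+β) (All.++⁺ (All.map⁺ α-adm) (All.map⁺ β-adm))

    length-L : length L ≡ length α + length β
    length-L = begin
      length L                                 ≡⟨ ↭-length L↭α+β ⟩
      length (tagα α ++ tagβ β)                ≡⟨ length-++ (tagα α) ⟩
      length (tagα α) + length (tagβ β)        ≡⟨ cong₂ _+_ (length-map _ α) (length-map _ β) ⟩
      length α + length β                      ∎
      where open ≡-Reasoning

    μ-admissible₀ : ∀ i → i ≤ length L → Admissible₀ (mu L i)
    μ-admissible₀ zero _ = inj₁ refl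
    μ-admissible₀ (suc i) i<n = inj₂ (mu-All i L-adm i<n)

    Phi≡ord+r : ∀ np {i k} → i < length L → [- mu L i ]₀ < k → k ≤ [- mu L (suc i) ]₀ →
                Phi np L i ≡ ord p (A α β k) ℤ.+ + np
    Phi≡ord+r np {i} {k} i<n μᵢ<k k≤μᵢ₊₁ = begin
      + np ℤ.+ stepSum (take i L)                     ≡⟨ cong (λ l → + np ℤ.+ stepSum l) L-below≡take ⟨
      + np ℤ.+ stepSum (filter below? L)               ≡⟨ cong (ℤ._+_ (+ np)) (stepSum-↭ (filter-↭ below? L↭α+β)) ⟩
      + np ℤ.+ stepSum (filter below? (tagα α ++ tagβ β)) ≡⟨ cong (ℤ._+_ (+ np)) (ord-A α-adm β-adm k≤p) ⟨
      + np ℤ.+ ord p (A α β k)                         ≡⟨ ℤ.+-comm (+ np) (ord p (A α β k)) ⟩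
      ord p (A α β k) ℤ.+ + np                         ∎
      where
      open ≡-Reasoning
      below? : Decidable (λ e → [- proj₁ e ]₀ < k)
      below? e = [- proj₁ e ]₀<? k
      L-below≡take : filter below? L ≡ take i L
      L-below≡take = filter-below≡take [-_]₀ refl L i (sorted-by-[-]₀ L-adm L-sorted) i<n μᵢ<k k≤μᵢ₊₁
      k≤p : k ≤ p
      k≤p = <⇒≤ (≤-<-trans k≤μᵢ₊₁ ([-]₀<p (mu L (suc i))))

    Phi≡ord+r-at-μ[p-1] : ∀ np {i k} → i < length L → mu L i ℚ.< mu L (suc i) →
                          + k ℚ./ 1 ≡ mu L (suc i) ℚ.* (+ (p ∸ 1) ℚ./ 1) → Phi np L i ≡ ord p (A α β k) ℤ.+ + np
    Phi≡ord+r-at-μ[p-1] np {i} {k} i<n μᵢ<μᵢ₊₁ k≡μᵢ₊₁[p-1] =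
      Phi≡ord+r np i<n (subst ([- mu L i ]₀ <_) (sym k≡[-μᵢ₊₁]₀) ([-]₀-mono-< μᵢ-adm μᵢ₊₁-adm μᵢ<μᵢ₊₁)) (≤-reflexive k≡[-μᵢ₊₁]₀)
      where
      μᵢ-adm : Admissible₀ (mu L i)
      μᵢ-adm = μ-admissible₀ i (<⇒≤ i<n)
      μᵢ₊₁-adm : Admissible₀ (mu L (suc i))
      μᵢ₊₁-adm = μ-admissible₀ (suc i) i<n
      k≡[-μᵢ₊₁]₀ : k ≡ [- mu L (suc i) ]₀
      k≡[-μᵢ₊₁]₀ = ℕ/1-injective (trans k≡μᵢ₊₁[p-1] (sym ([-]₀-scaled₀ μᵢ₊₁-adm)))

proposition3p1 :
    (α β : List ℚ) → length α ≡ length β →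
    All (λ a → 0ℚ ℚ.< a × a ℚ.≤ 1ℚ) α →
    All (λ b → 0ℚ ℚ.< b × b ℚ.≤ 1ℚ) β →
    1ℚ ∈ β →
    (∀ x y → 0ℚ ℚ.< x × x ℚ.≤ 1ℚ → 0ℚ ℚ.< y × y ℚ.≤ 1ℚ →
      denominatorℕ x ≡ denominatorℕ y → count x α ≡ count y α) →
    (∀ x y → 0ℚ ℚ.< x × x ℚ.≤ 1ℚ → 0ℚ ℚ.< y × y ℚ.≤ 1ℚ →
      denominatorℕ x ≡ denominatorℕ y → count x β ≡ count y β) →
    (ps qs : List ℕ) →
    All (λ n → 0 ℕ.< n) ps → All (λ n → 0 ℕ.< n) qs →
    (∀ n → n ∈ ps → n ∉ qs) →
    (∀ x → 0ℚ ℚ.< x × x ℚ.≤ 1ℚ →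
      + count x α ℤ.- + count x β
        ≡ + sum (map (λ n → rootMult n x) ps) ℤ.- + sum (map (λ n → rootMult n x) qs)) →
    (L : List (ℚ × Bool)) → L ↭ (tagα α ++ tagβ β) → Linked TagLe L →
    (p : ℕ) → Prime p → lcd (α ++ β) ∣ p ∸ 1 →
    (∀ i → i ℕ.< length α + length β → ∀ k →
      digit0 p (ℚ.- mu L i) ℕ.< k → k ℕ.≤ digit0 p (ℚ.- mu L (suc i)) →
      Phi (length ps) L i ≡ ord p (A α β k) ℤ.+ + length ps)
    ×
    (∀ i → i ℕ.< length α + length β → mu L i ℚ.< mu L (suc i) → ∀ k →
      (+ k ℚ./ 1) ≡ mu L (suc i) ℚ.* (+ (p ∸ 1) ℚ./ 1) →
      Phi (length ps) L i ≡ ord p (A α β k) ℤ.+ + length ps)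
-- Only the ranges of α and β and lcd (α ++ β) ∣ p − 1 are used.
proposition3p1 _ _ _ _ _ _ _ _ _ _ _ _ _ _ _ _ _ 0 p-prime _ = contradiction p-prime ¬prime[0]
proposition3p1 _ _ _ _ _ _ _ _ _ _ _ _ _ _ _ _ _ 1 p-prime _ = contradiction p-prime ¬prime[1]
proposition3p1 α β _ α-range β-range _ _ _ ps _ _ _ _ _ L L↭α+β L-sorted (2+ p-2) p-prime lcd∣p-1 =
  (λ i i<2m k → Phi≡ord+r (length ps) {k = k} (i<length-L i<2m)) ,
  (λ i i<2m μᵢ<μᵢ₊₁ k → Phi≡ord+r-at-μ[p-1] (length ps) {k = k} (i<length-L i<2m) μᵢ<μᵢ₊₁)
  where
  α+β-adm : All (Admissible p-prime) (α ++ β)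
  α+β-adm = All.zipWith (λ ((0<x , x≤1) , d∣lcd) → admissible p-prime 0<x x≤1 (∣-trans d∣lcd lcd∣p-1))
                        (All.++⁺ α-range β-range , lcd-dvd (α ++ β))
  open Sorted p-prime (All.++⁻ˡ α α+β-adm) (All.++⁻ʳ α α+β-adm) L↭α+β L-sorted
  i<length-L : ∀ {i} → i < length α + length β → i < length L
  i<length-L = subst (_ <_) (sym length-L)
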